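{- Let $G$ be a simple connected graph with $N=|V(G)|$ vertices. Then $G$ is radio graceful if and only if there exists an ordering $x_1,x_2,\dots,x_N$ of the vertices of $G$ (a list in one-to-one correspondence with $V(G)$) such that $$d(x_i,x_{i+\Delta})\geq \mathrm{diam}(G)-\Delta+1$$ for all $\Delta\in\{1,2,\dots,\mathrm{diam}(G)-1\}$ and all $i\in\{1,2,\dots,N-\Delta\}$.
   Context: For a simple connected graph $G$, a map $f:V(G)\to\mathbb{Z}_+$ is a radio labeling if $|f(u)-f(v)|\geq \mathrm{diam}(G)+1-d(u,v)$ for all distinct $u,v\in V(G)$, where $d$ is the graph distance. A radio labeling is consecutive if $f(V(G))=\{1,2,\dots,|V(G)|\}$, and $G$ is radio graceful if it admits a consecutive radio labeling. -}

module Defs where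

open import Data.Nat using (ℕ; zero; suc; _+_; _∸_; _≤_; _<_; ∣_-_∣)
open import Data.Fin using (Fin; toℕ)
open import Data.Product using (Σ; ∃; _×_; _,_)
open import Relation.Nullary using (¬_)
open import Relation.Binary.PropositionalEquality using (_≡_; _≢_)
open import Function.Definitions using (Injective; Surjective)

record Graph : Set₁ where
  field
    N      : ℕ
    Adj    : Fin N → Fin N → Set
    sym    : ∀ {u v} → Adj u v → Adj v u
    irrefl : ∀ {u} → ¬ Adj u u
open Graph public

data Walk (G : Graph) : ℕ → Fin (N G) → Fin (N G) → Set where
  here : ∀ {u} → Walk G zero u u
  step : ∀ {k u w v} → Adj G u w → Walk G k w v → Walk G (suc k) u v

Dist : (G : Graph) → Fin (N G) → Fin (N G) → ℕ → Set
Dist G u v k = Walk G k u v × (∀ m → m < k → ¬ Walk G m u v)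

Connected : Graph → Set
Connected G = ∀ u v → ∃ λ k → Walk G k u v

IsDiam : Graph → ℕ → Set
IsDiam G D = (∀ u v k → Dist G u v k → k ≤ D)
           × Σ (Fin (N G)) λ u → Σ (Fin (N G)) λ v → Dist G u v D

IsRadioLabeling : (G : Graph) → ℕ → (Fin (N G) → ℕ) → Set
IsRadioLabeling G D f =
  (∀ v → 1 ≤ f v) ×
  (∀ u v → u ≢ v → ∀ k → Dist G u v k → D + 1 ∸ k ≤ ∣ f u - f v ∣)

IsConsecutive : (G : Graph) → (Fin (N G) → ℕ) → Set
IsConsecutive G f =
  (∀ v → 1 ≤ f v × f v ≤ N G) ×
  (∀ m → 1 ≤ m → m ≤ N G → ∃ λ v → f v ≡ m)

RadioGraceful : (G : Graph) → ℕ → Set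
RadioGraceful G D = Σ (Fin (N G) → ℕ) λ f → IsRadioLabeling G D f × IsConsecutive G f

-- An ordering x_1,…,x_N (0-indexed here) in bijection with V(G) such that
-- d(x_i, x_{i+Δ}) ≥ D - Δ + 1 for 1 ≤ Δ ≤ D - 1.
GoodOrdering : (G : Graph) → ℕ → Set
GoodOrdering G D = Σ (Fin (N G) → Fin (N G)) λ x →
  Injective _≡_ _≡_ x × Surjective _≡_ _≡_ x ×
  (∀ (Δ : ℕ) → 1 ≤ Δ → Δ ≤ D ∸ 1 → ∀ (i j : Fin (N G)) → toℕ j ≡ toℕ i + Δ →
     ∀ k → Dist G (x i) (x j) k → D ∸ Δ + 1 ≤ k)

-- A consecutive labeling f and an ordering x of the vertices determine each other
-- through f (x i) = i + 1, and then |f (x i) - f (x j)| = |i - j|.  For vertices Δ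
-- positions apart the radio condition therefore reads D + 1 - d ≤ Δ, i.e.
-- d ≥ D - Δ + 1; when Δ ≥ D it holds for free, distinct vertices being at distance
-- at least 1.  A radio labeling is injective since D + 1 - d ≥ 1 whenever d ≤ D, so
-- a consecutive one is a bijection onto {1, …, N}.
module Submission where

open import Defs
open import Data.Nat using (ℕ; zero; suc; _+_; _∸_; _≤_; _<_; _≤?_; ∣_-_∣; z≤n; s≤s; s≤s⁻¹; pred)
open import Data.Nat.Properties
open import Data.Nat.Induction using (<-rec)
open import Data.Fin using (Fin; toℕ; fromℕ<) renaming (_≟_ to _≟ᶠ_)
open import Data.Fin.Properties using (toℕ-injective; toℕ<n; toℕ-fromℕ<)
open import Data.Product using (∃; _×_; _,_; proj₁; proj₂)
open import Data.Empty using (⊥-elim)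
open import Relation.Nullary using (¬_; yes; no)
open import Relation.Binary.PropositionalEquality
  using (_≡_; _≢_; refl; cong; cong₂; subst)
  renaming (sym to ≡-sym; trans to ≡-trans)
open import Relation.Binary.Definitions using (tri<; tri≈; tri>)
open import Function.Bundles using (_⇔_; mk⇔)
open import Function.Base using (_∘_)
open import Function.Definitions using (Injective; Surjective)

m∸n≤o⇒m∸o≤n : ∀ m n o → m ∸ n ≤ o → m ∸ o ≤ n
m∸n≤o⇒m∸o≤n m n o m∸n≤o =
  m≤n+o⇒m∸n≤o m o
    (≤-trans (m≤n+m∸n m n) (≤-trans (+-monoʳ-≤ n m∸n≤o) (≤-reflexive (+-comm n o))))

pred[m]<n⇒m≤n : ∀ {m n} → pred m < n → m ≤ n
pred[m]<n⇒m≤n {n = n} pred[m]<n = s≤s⁻¹ (pred-cancel-< {n = suc n} pred[m]<n)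

module _ {G : Graph} where

  snoc : ∀ {k u w v} → Walk G k u w → Adj G w v → Walk G (suc k) u v
  snoc here       a = step a here
  snoc (step b w) a = step b (snoc w a)

  reverse : ∀ {k u v} → Walk G k u v → Walk G k v u
  reverse here       = here
  reverse (step a w) = snoc (reverse w) (Graph.sym G a)

  Dist-sym : ∀ {u v k} → Dist G u v k → Dist G v u k
  Dist-sym (w , shortest) = reverse w , λ m m<k w′ → shortest m m<k (reverse w′)

  Dist-positive : ∀ {u v k} → u ≢ v → Dist G u v k → 1 ≤ k
  Dist-positive {k = zero}  u≢v (here , _) = ⊥-elim (u≢v refl)
  Dist-positive {k = suc _} _   _          = s≤s z≤n

  -- Adjacency is an arbitrary Set, so the least walk length is only available
  -- under double negation.
  walk⇒¬¬dist : ∀ {k u v} → Walk G k u v → ¬ ¬ ∃ (Dist G u v)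
  walk⇒¬¬dist {k} {u} {v} = <-rec P descend k
    where
    P : ℕ → Set
    P k = Walk G k u v → ¬ ¬ ∃ (Dist G u v)
    descend : ∀ k → (∀ {m} → m < k → P m) → P k
    descend k shorter w no-dist = no-dist (k , w , λ m m<k w′ → shorter m<k w′ no-dist)

RadioCondition : (G : Graph) → ℕ → (Fin (N G) → ℕ) → Set
RadioCondition G D f = ∀ u v → u ≢ v → ∀ k → Dist G u v k → D + 1 ∸ k ≤ ∣ f u - f v ∣

radioCondition-injective : ∀ {G D f} → Connected G → (∀ u v k → Dist G u v k → k ≤ D) →
                           RadioCondition G D f → Injective _≡_ _≡_ f
radioCondition-injective {G} {D} {f} conn dist≤D radio {u} {v} fu≡fv with u ≟ᶠ v
... | yes u≡v = u≡v
... | no u≢v  = ⊥-elim (walk⇒¬¬dist (proj₂ (conn u v)) λ (k , d) →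
  let D+1∸k≤0 : D + 1 ∸ k ≤ 0
      D+1∸k≤0 = subst (D + 1 ∸ k ≤_) (≡-trans (cong (∣ f u -_∣) (≡-sym fu≡fv)) (∣n-n∣≡0 (f u)))
                      (radio u v u≢v k d)
  in m+1+n≰m D (≤-trans (m∸n≤o⇒m∸o≤n (D + 1) k 0 D+1∸k≤0) (dist≤D u v k d)))

LabelsPositions : ∀ {n} → (Fin n → ℕ) → (Fin n → Fin n) → Set
LabelsPositions f x = ∀ i → f (x i) ≡ suc (toℕ i)

labelsPositions-injective : ∀ {n} {f : Fin n → ℕ} {x} → LabelsPositions f x → Injective _≡_ _≡_ x
labelsPositions-injective {f = f} {x} lab {i} {j} xi≡xj =
  toℕ-injective (suc-injective (≡-trans (≡-sym (lab i)) (≡-trans (cong f xi≡xj) (lab j))))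

suc-position : ∀ {n m} → 1 ≤ m → m ≤ n → ∃ λ (i : Fin n) → suc (toℕ i) ≡ m
suc-position {m = suc m} _ m<n = fromℕ< m<n , cong suc (toℕ-fromℕ< m<n)

module _ {G : Graph} where

  ordering-of-labeling : ∀ {f} → Injective _≡_ _≡_ f → IsConsecutive G f →
                         ∃ λ x → Surjective _≡_ _≡_ x × LabelsPositions f x
  ordering-of-labeling {f} f-inj (range , onto) = x , x-surj , lab
    where
    x : Fin (N G) → Fin (N G)
    x i = proj₁ (onto (suc (toℕ i)) (s≤s z≤n) (toℕ<n i))
    lab : LabelsPositions f x
    lab i = proj₂ (onto (suc (toℕ i)) (s≤s z≤n) (toℕ<n i))
    x-surj : Surjective _≡_ _≡_ x
    x-surj v with suc-position (proj₁ (range v)) (proj₂ (range v))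
    ... | i , i+1≡fv = i , λ { refl → f-inj (≡-trans (lab i) i+1≡fv) }

  labeling-of-ordering : ∀ {x} → Injective _≡_ _≡_ x → Surjective _≡_ _≡_ x →
                         ∃ λ f → IsConsecutive G f × LabelsPositions f x
  labeling-of-ordering {x} x-inj x-surj = f , (range , onto) , lab
    where
    position : Fin (N G) → Fin (N G)
    position v = proj₁ (x-surj v)
    f : Fin (N G) → ℕ
    f v = suc (toℕ (position v))
    lab : LabelsPositions f x
    lab i = cong (suc ∘ toℕ) (x-inj (proj₂ (x-surj (x i)) refl))
    range : ∀ v → 1 ≤ f v × f v ≤ N G
    range v = s≤s z≤n , toℕ<n (position v)
    onto : ∀ m → 1 ≤ m → m ≤ N G → ∃ λ v → f v ≡ m
    onto m 1≤m m≤N with suc-position 1≤m m≤N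
    ... | i , i+1≡m = x i , ≡-trans (lab i) i+1≡m

label-distance : ∀ {n} {f : Fin n → ℕ} {x} → LabelsPositions f x →
                 ∀ i j → ∣ f (x i) - f (x j) ∣ ≡ ∣ toℕ i - toℕ j ∣
label-distance lab i j = cong₂ ∣_-_∣ (lab i) (lab j)

Spaced : (G : Graph) → ℕ → (Fin (N G) → Fin (N G)) → Set
Spaced G D x = ∀ (Δ : ℕ) → 1 ≤ Δ → Δ ≤ D ∸ 1 → ∀ (i j : Fin (N G)) → toℕ j ≡ toℕ i + Δ →
               ∀ k → Dist G (x i) (x j) k → D ∸ Δ + 1 ≤ k

module _ {G : Graph} {D : ℕ} where

  radio⇒spaced : ∀ {f x} → LabelsPositions f x → RadioCondition G D f → Spaced G D x
  radio⇒spaced {f} {x} lab radio Δ@(suc _) _ Δ≤D∸1 i j j≡i+Δ k d =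
    subst (_≤ k) (+-∸-comm 1 (≤-trans Δ≤D∸1 (m∸n≤m D 1)))
      (m∸n≤o⇒m∸o≤n (D + 1) k Δ (subst (D + 1 ∸ k ≤_) fxi-fxj≡Δ (radio (x i) (x j) xi≢xj k d)))
    where
    xi≢xj : x i ≢ x j
    xi≢xj xi≡xj = m+1+n≢m (toℕ i)
      (≡-sym (≡-trans (cong toℕ (labelsPositions-injective {f = f} lab xi≡xj)) j≡i+Δ))
    fxi-fxj≡Δ : ∣ f (x i) - f (x j) ∣ ≡ Δ
    fxi-fxj≡Δ = ≡-trans (label-distance {f = f} lab i j)
                        (≡-trans (cong (∣ toℕ i -_∣) j≡i+Δ) (∣m-m+n∣≡n (toℕ i) Δ))

  spaced⇒separated : ∀ {x} → Spaced G D x → ∀ i j → toℕ i < toℕ j →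
                     ∀ k → 1 ≤ k → Dist G (x i) (x j) k → D + 1 ∸ k ≤ toℕ j ∸ toℕ i
  spaced⇒separated spaced i j i<j k 1≤k d = m∸n≤o⇒m∸o≤n (D + 1) Δ k separation
    where
    Δ : ℕ
    Δ = toℕ j ∸ toℕ i
    separation : D + 1 ∸ Δ ≤ k
    separation with Δ ≤? D ∸ 1
    ... | yes Δ≤D∸1 = subst (_≤ k) (≡-sym (+-∸-comm 1 (≤-trans Δ≤D∸1 (m∸n≤m D 1))))
                        (spaced Δ (m<n⇒0<n∸m i<j) Δ≤D∸1 i j (≡-sym (m+[n∸m]≡n (<⇒≤ i<j))) k d)
    ... | no Δ≰D∸1  = ≤-trans (∸-monoʳ-≤ (D + 1) (pred[m]<n⇒m≤n {D} (≰⇒> Δ≰D∸1)))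
                        (≤-trans (≤-reflexive (m+n∸m≡n D 1)) 1≤k)

  spaced⇒separated-∣∣ : ∀ {x} → Spaced G D x → ∀ i j → x i ≢ x j →
                        ∀ k → Dist G (x i) (x j) k → D + 1 ∸ k ≤ ∣ toℕ i - toℕ j ∣
  spaced⇒separated-∣∣ {x} spaced i j xi≢xj k d with <-cmp (toℕ i) (toℕ j)
  ... | tri< i<j _ _ = subst (D + 1 ∸ k ≤_) (≡-sym (m≤n⇒∣m-n∣≡n∸m (<⇒≤ i<j)))
                         (spaced⇒separated spaced i j i<j k (Dist-positive xi≢xj d) d)
  ... | tri≈ _ i≡j _ = ⊥-elim (xi≢xj (cong x (toℕ-injective i≡j)))
  ... | tri> _ _ j<i = subst (D + 1 ∸ k ≤_) (≡-sym (m≤n⇒∣n-m∣≡n∸m (<⇒≤ j<i)))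
                         (spaced⇒separated spaced j i j<i k (Dist-positive xi≢xj d) (Dist-sym d))

  spaced⇒radio : ∀ {f x} → Surjective _≡_ _≡_ x → LabelsPositions f x → Spaced G D x →
                 RadioCondition G D f
  spaced⇒radio {f} {x} x-surj lab spaced u v u≢v k d with x-surj u | x-surj v
  ... | i , xi≡u | j , xj≡v with xi≡u refl | xj≡v refl
  ... | refl | refl = subst (D + 1 ∸ k ≤_) (≡-sym (label-distance {f = f} lab i j))
                        (spaced⇒separated-∣∣ spaced i j u≢v k d)

mainTheorem2 : (G : Graph) → Connected G → (D : ℕ) → IsDiam G D →
    (RadioGraceful G D ⇔ GoodOrdering G D)
mainTheorem2 G conn D (dist≤D , _) = mk⇔ to from
  where
  to : RadioGraceful G D → GoodOrdering G D
  to (f , (_ , radio) , consecutive)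
    with ordering-of-labeling {G} {f} (radioCondition-injective conn dist≤D radio) consecutive
  ... | x , x-surj , lab =
    x , labelsPositions-injective {f = f} lab , x-surj , radio⇒spaced {f = f} lab radio

  from : GoodOrdering G D → RadioGraceful G D
  from (x , x-inj , x-surj , spaced) with labeling-of-ordering {G} x-inj x-surj
  ... | f , consecutive , lab =
    f , ((λ v → proj₁ (proj₁ consecutive v)) , spaced⇒radio {f = f} x-surj lab spaced) , consecutive
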